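{- Let $\mathscr{D}$ be a commutative variety of algebras, and let $X,Y$ be objects of $\mathscr{D}$. Consider the endofunctor $TQ=Y\times[X,Q]$ on $\mathscr{D}$. The object $[X^{\circledast},Y]$ carries a $T$-coalgebra structure $(\tau,f)$ given on elements as follows: the output $f:[X^{\circledast},Y]\to Y$ sends $L$ to $L(\varepsilon)$, where $\varepsilon$ is the unit of $X^{\circledast}$, and the transition $\tau:[X^{\circledast},Y]\to[X,[X^{\circledast},Y]]$ sends $L$ to the morphism $a\mapsto L(\eta_X(a)\bullet -)$. Then $([X^{\circledast},Y],\tau,f)$ is a final $T$-coalgebra.
   Context: A variety of algebras $\mathscr{D}$ is commutative (entropic) if for all objects $A,B$ the set of homomorphisms $\mathscr{D}(A,B)$ is a subalgebra $[A,B]$ of $B^{|A|}$. Then $\mathscr{D}$ has tensor products $A\otimes B$ (representing bimorphisms, i.e. maps $|A|\times|B|\to|C|$ that are homomorphisms in each variable), unit $I=\Psi 1$ (free algebra on one generator), and is symmetric monoidal closed with internal hom $[B,C]$. A $\mathscr{D}$-monoid is $(M,\bullet,i)$ with $(|M|,\bullet,i)$ a monoid and $\bullet$ a bimorphism. $X^{\otimes 0}=I$, $X^{\otimes(n+1)}=X\otimes X^{\otimes n}$, and the free $\mathscr{D}$-monoid on $X$ is $X^{\circledast}=\coprod_{n<\omega}X^{\otimes n}$ with unit the $0$-th coproduct injection $I\to X^{\circledast}$, multiplication whose $(n,k)$-component $X^{\otimes n}\otimes X^{\otimes k}\to X^{\circledast}$ is the $(n+k)$-th coproduct injection, and universal arrow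 $\eta_X:X\to X^{\circledast}$ the first coproduct injection. A $T$-coalgebra is a pair $(Q,\gamma:Q\to TQ)$; homomorphisms commute with the structures. -}

module Defs where

open import Data.Nat using (ℕ)
open import Data.Fin using (Fin)
open import Data.Product using (Σ; _×_; _,_; proj₁; proj₂)
open import Relation.Binary using (IsEquivalence)

record Signature : Set₁ where
  field
    Op    : Set
    arity : Op → ℕ

module _ (Σg : Signature) where
  open Signature Σg

  data Term (V : Set) : Set where
    var  : V → Term V
    node : (o : Op) → (Fin (arity o) → Term V) → Term V

record Variety : Set₁ where
  field
    sig   : Signature
  open Signature sig public
  field
    Eqn   : Set
    nvars : Eqn → ℕ
    lhs   : (e : Eqn) → Term sig (Fin (nvars e))
    rhs   : (e : Eqn) → Term sig (Fin (nvars e))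

module _ (D : Variety) where
  open Variety D

  record Structure : Set₁ where
    field
      Carrier       : Set
      _≈_           : Carrier → Carrier → Set
      isEquivalence : IsEquivalence _≈_
      op            : (o : Op) → (Fin (arity o) → Carrier) → Carrier
      op-cong       : ∀ o {xs ys : Fin (arity o) → Carrier} →
                      (∀ i → xs i ≈ ys i) → op o xs ≈ op o ys

    ⟦_⟧ : ∀ {V} → Term sig V → (V → Carrier) → Carrier
    ⟦ var v ⟧ ρ     = ρ v
    ⟦ node o ts ⟧ ρ = op o (λ i → ⟦ ts i ⟧ ρ)

  record Alg : Set₁ where
    field
      str : Structure
    open Structure str public
    field
      sat : ∀ e (ρ : Fin (nvars e) → Carrier) → ⟦ lhs e ⟧ ρ ≈ ⟦ rhs e ⟧ ρ

  open Alg

  PreservesOps : (A B : Alg) → (Carrier A → Carrier B) → Set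
  PreservesOps A B f = ∀ o (xs : Fin (arity o) → Carrier A) →
    _≈_ B (f (op A o xs)) (op B o (λ i → f (xs i)))

  record Hom (A B : Alg) : Set where
    field
      fun  : Carrier A → Carrier B
      cong : ∀ {x y} → _≈_ A x y → _≈_ B (fun x) (fun y)
      hom  : PreservesOps A B fun
  open Hom public

-- 𝒟 is commutative (entropic): for all A, B the homomorphisms 𝒟(A,B)
-- form a subalgebra of B^{|A|}, i.e. they are closed under the
-- pointwise operations.
IsCommutative : Variety → Set₁
IsCommutative D = ∀ (A B : Alg D) (o : Op) (hs : Fin (arity o) → Hom D A B) →
  PreservesOps D A B (λ a → Alg.op B o (λ i → fun (hs i) a))
  where open Variety D

module Comm (D : Variety) (comm : IsCommutative D) where
  open Variety D
  open Alg

  module _ {A : Alg D} where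
    open IsEquivalence (isEquivalence A) public
      renaming (refl to ≈refl; sym to ≈sym; trans to ≈trans)

  homStr : Alg D → Alg D → Structure D
  homStr A B = record
    { Carrier       = Hom D A B
    ; _≈_           = λ f g → ∀ a → _≈_ B (fun f a) (fun g a)
    ; isEquivalence = record
        { refl  = λ a → ≈refl {B}
        ; sym   = λ p a → ≈sym {B} (p a)
        ; trans = λ p q a → ≈trans {B} (p a) (q a) }
    ; op      = λ o hs → record
        { fun  = λ a → op B o (λ i → fun (hs i) a)
        ; cong = λ x≈y → op-cong B o (λ i → cong (hs i) x≈y)
        ; hom  = comm A B o hs }
    ; op-cong = λ o ps a → op-cong B o (λ i → ps i a)
    }

  homEval : (A B : Alg D) {V : Set} (t : Term sig V) (ρ : V → Hom D A B) (a : Carrier A) →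
    _≈_ B (fun (Structure.⟦_⟧ (homStr A B) t ρ) a) (⟦_⟧ B t (λ v → fun (ρ v) a))
  homEval A B (var v) ρ a = ≈refl {B}
  homEval A B (node o ts) ρ a = op-cong B o (λ i → homEval A B (ts i) ρ a)

  [_,_] : Alg D → Alg D → Alg D
  [ A , B ] = record
    { str = homStr A B
    ; sat = λ e ρ a → ≈trans {B} (homEval A B (lhs e) ρ a)
                      (≈trans {B} (sat B e (λ v → fun (ρ v) a))
                                  (≈sym {B} (homEval A B (rhs e) ρ a))) }

  prodStr : Alg D → Alg D → Structure D
  prodStr A B = record
    { Carrier       = Carrier A × Carrier B
    ; _≈_           = λ p q → _≈_ A (proj₁ p) (proj₁ q) × _≈_ B (proj₂ p) (proj₂ q)
    ; isEquivalence = record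
        { refl  = ≈refl {A} , ≈refl {B}
        ; sym   = λ p → ≈sym {A} (proj₁ p) , ≈sym {B} (proj₂ p)
        ; trans = λ p q → ≈trans {A} (proj₁ p) (proj₁ q) , ≈trans {B} (proj₂ p) (proj₂ q) }
    ; op      = λ o xs → op A o (λ i → proj₁ (xs i)) , op B o (λ i → proj₂ (xs i))
    ; op-cong = λ o ps → op-cong A o (λ i → proj₁ (ps i)) , op-cong B o (λ i → proj₂ (ps i))
    }

  prodEval : (A B : Alg D) {V : Set} (t : Term sig V) (ρ : V → Carrier A × Carrier B) →
    _≈_ A (proj₁ (Structure.⟦_⟧ (prodStr A B) t ρ)) (⟦_⟧ A t (λ v → proj₁ (ρ v)))
    × _≈_ B (proj₂ (Structure.⟦_⟧ (prodStr A B) t ρ)) (⟦_⟧ B t (λ v → proj₂ (ρ v)))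
  prodEval A B (var v) ρ = ≈refl {A} , ≈refl {B}
  prodEval A B (node o ts) ρ =
    op-cong A o (λ i → proj₁ (prodEval A B (ts i) ρ)) ,
    op-cong B o (λ i → proj₂ (prodEval A B (ts i) ρ))

  _⊗×_ : Alg D → Alg D → Alg D
  A ⊗× B = record
    { str = prodStr A B
    ; sat = λ e ρ →
        ≈trans {A} (proj₁ (prodEval A B (lhs e) ρ))
          (≈trans {A} (sat A e (λ v → proj₁ (ρ v))) (≈sym {A} (proj₁ (prodEval A B (rhs e) ρ)))) ,
        ≈trans {B} (proj₂ (prodEval A B (lhs e) ρ))
          (≈trans {B} (sat B e (λ v → proj₂ (ρ v))) (≈sym {B} (proj₂ (prodEval A B (rhs e) ρ)))) }

  _∘H_ : {A B C : Alg D} → Hom D B C → Hom D A B → Hom D A C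
  _∘H_ {A} {B} {C} g f = record
    { fun  = λ a → fun g (fun f a)
    ; cong = λ p → cong g (cong f p)
    ; hom  = λ o xs → ≈trans {C} (cong g (hom f o xs)) (hom g o (λ i → fun f (xs i))) }

  record DMonoid : Set₁ where
    field
      alg   : Alg D
    open Alg alg using () renaming (Carrier to |M|; _≈_ to _≈M_)
    field
      _•_     : |M| → |M| → |M|
      unit    : |M|
      •-cong  : ∀ {x x' y y'} → x ≈M x' → y ≈M y' → (x • y) ≈M (x' • y')
      assoc   : ∀ x y z → ((x • y) • z) ≈M (x • (y • z))
      identityˡ : ∀ x → (unit • x) ≈M x
      identityʳ : ∀ x → (x • unit) ≈M x
      bimˡ : ∀ y → PreservesOps D alg alg (λ x → x • y)
      bimʳ : ∀ x → PreservesOps D alg alg (λ y → x • y)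

  open DMonoid

  record MonHom (M N : DMonoid) : Set where
    field
      h     : Hom D (alg M) (alg N)
      h-•   : ∀ x y → _≈_ (alg N) (fun h (_•_ M x y)) (_•_ N (fun h x) (fun h y))
      h-unit : _≈_ (alg N) (fun h (unit M)) (unit N)
  open MonHom

  IsFreeDMonoid : (X : Alg D) (M : DMonoid) → Hom D X (alg M) → Set₁
  IsFreeDMonoid X M η = ∀ (N : DMonoid) (g : Hom D X (alg N)) →
    Σ (MonHom M N) λ u →
      (∀ x → _≈_ (alg N) (fun (h u) (fun η x)) (fun g x)) ×
      (∀ (u' : MonHom M N) → (∀ x → _≈_ (alg N) (fun (h u') (fun η x)) (fun g x)) →
         ∀ m → _≈_ (alg N) (fun (h u') m) (fun (h u) m))

  module Functor (X Y : Alg D) where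

    T : Alg D → Alg D
    T Q = Y ⊗× [ X , Q ]

    Tmap : {Q Q' : Alg D} → Hom D Q Q' → Carrier (T Q) → Carrier (T Q')
    Tmap h (y , k) = y , (h ∘H k)

    record Coalg : Set₁ where
      constructor coalg
      field
        St : Alg D
        γ  : Hom D St (T St)
    open Coalg

    record CoalgHom (C C' : Coalg) : Set where
      field
        mor : Hom D (St C) (St C')
        commutes : ∀ q → _≈_ (T (St C')) (fun (γ C') (fun mor q)) (Tmap mor (fun (γ C) q))
    open CoalgHom

    IsFinal : Coalg → Set₁
    IsFinal Z = ∀ (C : Coalg) → Σ (CoalgHom C Z) λ u →
      ∀ (u' : CoalgHom C Z) → ∀ q → _≈_ (St Z) (fun (mor u') q) (fun (mor u) q)

-- Given any
-- coalgebra (Q, γ), the transitions form a homomorphism X → [Q , Q] into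
-- the endomorphism monoid of Q, which by freeness extends to an action
-- q ⋆ w of words on states; the behaviour of q is then w ↦ out (q ⋆ w).
-- Conversely any coalgebra homomorphism U satisfies U (q ⋆ w) v ≈ U q (w • v),
-- because the words w with this property form a sub-𝒟-monoid containing
-- the generators; evaluating at v = ε shows U is the behaviour map.
module Submission where

open import Defs
open import Data.Product using (Σ; _×_; _,_; proj₁; proj₂)
open import Relation.Binary.Bundles using (Setoid)
import Relation.Binary.Reasoning.Setoid as SetoidReasoning

module _ (D : Variety) (comm : IsCommutative D) where
  open Variety D using (sig; lhs; rhs)
  open Comm D comm
  open Alg using (Carrier; op; op-cong)
  open MonHom

  ≈-syntax : (A : Alg D) → Carrier A → Carrier A → Set
  ≈-syntax = Alg._≈_
  infix 4 ≈-syntax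
  syntax ≈-syntax A x y = x ≈[ A ] y

  setoid : Alg D → Setoid _ _
  setoid A = record { isEquivalence = Alg.isEquivalence A }

  module ≈-Reasoning (A : Alg D) = SetoidReasoning (setoid A)

  idMonHom : (M : DMonoid) → MonHom M M
  idMonHom M = record
    { h      = record { fun = λ x → x ; cong = λ p → p ; hom = λ _ _ → ≈refl {A} }
    ; h-•    = λ _ _ → ≈refl {A}
    ; h-unit = ≈refl {A} }
    where
    A : Alg D
    A = DMonoid.alg M

  _∘M_ : {L M N : DMonoid} → MonHom M N → MonHom L M → MonHom L N
  _∘M_ {N = N} g f = record
    { h      = h g ∘H h f
    ; h-•    = λ x y → ≈trans {A} (cong (h g) (h-• f x y)) (h-• g _ _)
    ; h-unit = ≈trans {A} (cong (h g) (h-unit f)) (h-unit g) }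
    where
    A : Alg D
    A = DMonoid.alg N

  -- Composition is taken in diagrammatic order, so that the monoid acts on
  -- the right of Q: a word is read from left to right.
  endoMonoid : Alg D → DMonoid
  endoMonoid Q = record
    { alg       = [ Q , Q ]
    ; _•_       = λ f g → g ∘H f
    ; unit      = record { fun = λ q → q ; cong = λ p → p ; hom = λ _ _ → ≈refl {Q} }
    ; •-cong    = λ {_} {f'} {g} f≈f' g≈g' q → ≈trans {Q} (cong g (f≈f' q)) (g≈g' (fun f' q))
    ; assoc     = λ _ _ _ _ → ≈refl {Q}
    ; identityˡ = λ _ _ → ≈refl {Q}
    ; identityʳ = λ _ _ → ≈refl {Q}
    ; bimˡ      = λ g o fs q → hom g o (λ i → fun (fs i) q)
    ; bimʳ      = λ _ _ _ _ → ≈refl {Q} }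

  record IsSubmonoid (M : DMonoid) (P : Carrier (DMonoid.alg M) → Set) : Set where
    open DMonoid M
    field
      resp      : ∀ {v w} → v ≈[ alg ] w → P v → P w
      op-closed : ∀ o ws → (∀ i → P (ws i)) → P (op alg o ws)
      ε-closed  : P unit
      •-closed  : ∀ {v w} → P v → P w → P (v • w)

  module Submonoid {M : DMonoid} {P : Carrier (DMonoid.alg M) → Set}
                   (isSub : IsSubmonoid M P) where
    open DMonoid M
    open IsSubmonoid isSub

    structure : Structure D
    structure = record
      { Carrier       = Σ (Carrier alg) P
      ; _≈_           = λ x y → proj₁ x ≈[ alg ] proj₁ y
      ; isEquivalence = record { refl = ≈refl {alg} ; sym = ≈sym {alg} ; trans = ≈trans {alg} }
      ; op            = λ o xs → op alg o (λ i → proj₁ (xs i)) , op-closed o _ (λ i → proj₂ (xs i))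
      ; op-cong       = λ o → op-cong alg o }

    ⟦⟧-proj₁ : {V : Set} (t : Term sig V) (ρ : V → Σ (Carrier alg) P) →
      proj₁ (Structure.⟦_⟧ structure t ρ) ≈[ alg ] Alg.⟦_⟧ alg t (λ v → proj₁ (ρ v))
    ⟦⟧-proj₁ (var v)     ρ = ≈refl {alg}
    ⟦⟧-proj₁ (node o ts) ρ = op-cong alg o (λ i → ⟦⟧-proj₁ (ts i) ρ)

    submonoid : DMonoid
    submonoid = record
      { alg       = record
          { str = structure
          ; sat = λ e ρ → ≈trans {alg} (⟦⟧-proj₁ (lhs e) ρ)
                            (≈trans {alg} (Alg.sat alg e _) (≈sym {alg} (⟦⟧-proj₁ (rhs e) ρ))) }
      ; _•_       = λ x y → (proj₁ x • proj₁ y) , •-closed (proj₂ x) (proj₂ y)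
      ; unit      = unit , ε-closed
      ; •-cong    = •-cong
      ; assoc     = λ x y z → assoc (proj₁ x) (proj₁ y) (proj₁ z)
      ; identityˡ = λ x → identityˡ (proj₁ x)
      ; identityʳ = λ x → identityʳ (proj₁ x)
      ; bimˡ      = λ y o xs → bimˡ (proj₁ y) o (λ i → proj₁ (xs i))
      ; bimʳ      = λ x o xs → bimʳ (proj₁ x) o (λ i → proj₁ (xs i)) }

    inclusion : MonHom submonoid M
    inclusion = record
      { h      = record { fun = proj₁ ; cong = λ p → p ; hom = λ _ _ → ≈refl {alg} }
      ; h-•    = λ _ _ → ≈refl {alg}
      ; h-unit = ≈refl {alg} }

  module FreeDMonoid {X : Alg D} {M : DMonoid} {η : Hom D X (DMonoid.alg M)}
                     (free : IsFreeDMonoid X M η) where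
    open DMonoid M using (alg)

    extensions-agree : {N : DMonoid} (f g : MonHom M N) →
      (∀ x → fun (h f) (fun η x) ≈[ DMonoid.alg N ] fun (h g) (fun η x)) →
      ∀ m → fun (h f) m ≈[ DMonoid.alg N ] fun (h g) m
    extensions-agree {N} f g f≈g m =
      ≈trans {A} (unique f (λ _ → ≈refl {A}) m) (≈sym {A} (unique g (λ x → ≈sym {A} (f≈g x)) m))
      where
      A : Alg D
      A = DMonoid.alg N
      u : MonHom M N
      u = proj₁ (free N (h f ∘H η))
      unique : (v : MonHom M N) → (∀ x → fun (h v) (fun η x) ≈[ A ] fun (h f) (fun η x)) →
               ∀ m → fun (h v) m ≈[ A ] fun (h u) m
      unique = proj₂ (proj₂ (free N (h f ∘H η)))

    induction : {P : Carrier alg → Set} → IsSubmonoid M P → (∀ x → P (fun η x)) → ∀ m → P m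
    induction isSub Pη m = IsSubmonoid.resp isSub inclusion∘lift≈id (proj₂ (fun (h lift) m))
      where
      open Submonoid isSub
      ηˢ : Hom D X (DMonoid.alg submonoid)
      ηˢ = record { fun = λ x → fun η x , Pη x ; cong = cong η ; hom = hom η }
      lift : MonHom M submonoid
      lift = proj₁ (free submonoid ηˢ)
      inclusion∘lift≈id : proj₁ (fun (h lift) m) ≈[ alg ] m
      inclusion∘lift≈id =
        extensions-agree (inclusion ∘M lift) (idMonHom M) (proj₁ (proj₂ (free submonoid ηˢ))) m

  module Languages (X Y : Alg D) (M : DMonoid) (η : Hom D X (DMonoid.alg M)) where
    open Functor X Y
    open DMonoid M

    derivative : Hom D alg Y → Carrier X → Hom D alg Y
    derivative L a = record
      { fun  = λ w → fun L (fun η a • w)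
      ; cong = λ p → cong L (•-cong (≈refl {alg}) p)
      ; hom  = λ o ws → ≈trans {Y} (cong L (bimʳ (fun η a) o ws)) (hom L o _) }

    derivatives : Hom D alg Y → Hom D X [ alg , Y ]
    derivatives L = record
      { fun  = derivative L
      ; cong = λ p w → cong L (•-cong (cong η p) (≈refl {alg}))
      ; hom  = λ o as w → ≈trans {Y} (cong L (•-cong (hom η o as) (≈refl {alg})))
                            (≈trans {Y} (cong L (bimˡ w o _)) (hom L o _)) }

    languageStructure : Hom D [ alg , Y ] (T [ alg , Y ])
    languageStructure = record
      { fun  = λ L → fun L unit , derivatives L
      ; cong = λ L≈L' → L≈L' unit , (λ a w → L≈L' (fun η a • w))
      ; hom  = λ _ _ → ≈refl {Y} , (λ _ _ → ≈refl {Y}) }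

    languageCoalg : Coalg
    languageCoalg = coalg [ alg , Y ] languageStructure

  module Finality (X Y : Alg D) (M : DMonoid) (η : Hom D X (DMonoid.alg M))
                  (free : IsFreeDMonoid X M η) where
    open Functor X Y
    open Coalg
    open CoalgHom
    open DMonoid M
    open Languages X Y M η
    open FreeDMonoid {X} {M} {η} free

    module _ (C : Coalg) where
      private
        Q : Alg D
        Q = St C

      output : Hom D Q Y
      output = record
        { fun  = λ q → proj₁ (fun (γ C) q)
        ; cong = λ p → proj₁ (cong (γ C) p)
        ; hom  = λ o qs → proj₁ (hom (γ C) o qs) }

      transitions : Hom D X [ Q , Q ]
      transitions = record
        { fun  = λ a → record
            { fun  = λ q → fun (proj₂ (fun (γ C) q)) a
            ; cong = λ p → proj₂ (cong (γ C) p) a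
            ; hom  = λ o qs → proj₂ (hom (γ C) o qs) a }
        ; cong = λ p q → cong (proj₂ (fun (γ C) q)) p
        ; hom  = λ o as q → hom (proj₂ (fun (γ C) q)) o as }

      run : MonHom M (endoMonoid Q)
      run = proj₁ (free (endoMonoid Q) transitions)

      infixl 7 _⋆_
      _⋆_ : Carrier Q → Carrier alg → Carrier Q
      q ⋆ w = fun (fun (h run) w) q

      ⋆-η : ∀ q a → q ⋆ fun η a ≈[ Q ] fun (fun transitions a) q
      ⋆-η q a = proj₁ (proj₂ (free (endoMonoid Q) transitions)) a q

      behaviour : Hom D Q [ alg , Y ]
      behaviour = record
        { fun  = λ q → record
            { fun  = λ w → fun output (q ⋆ w)
            ; cong = λ p → cong output (cong (h run) p q)
            ; hom  = λ o ws → ≈trans {Y} (cong output (hom (h run) o ws q)) (hom output o _) }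
        ; cong = λ p w → cong output (cong (fun (h run) w) p)
        ; hom  = λ o qs w → ≈trans {Y} (cong output (hom (fun (h run) w) o qs)) (hom output o _) }

      behaviourHom : CoalgHom C languageCoalg
      behaviourHom = record
        { mor      = behaviour
        ; commutes = λ q → cong output (h-unit run q)
                         , λ a w → cong output (≈trans {Q} (h-• run (fun η a) w q)
                                                           (cong (fun (h run) w) (⋆-η q a))) }

      module _ (U : CoalgHom C languageCoalg) where
        private
          _[_] : Carrier Q → Carrier alg → Carrier Y
          q [ w ] = fun (fun (mor U) q) w

          [-]-cong : ∀ {q q'} w → q ≈[ Q ] q' → q [ w ] ≈[ Y ] q' [ w ]
          [-]-cong w q≈q' = cong (mor U) q≈q' w

        ⋆-shifts : ∀ w q v → (q ⋆ w) [ v ] ≈[ Y ] q [ w • v ]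
        ⋆-shifts = induction isSub shifts-η
          where
          Shifts : Carrier alg → Set
          Shifts w = ∀ q v → (q ⋆ w) [ v ] ≈[ Y ] q [ w • v ]

          shifts-η : ∀ a → Shifts (fun η a)
          shifts-η a q v = ≈trans {Y} ([-]-cong v (⋆-η q a)) (≈sym {Y} (proj₂ (commutes U q) a v))

          isSub : IsSubmonoid M Shifts
          isSub = record
            { resp      = λ {w} {w'} w≈w' Sw q v → begin
                (q ⋆ w') [ v ]  ≈⟨ [-]-cong v (cong (h run) w≈w' q) ⟨
                (q ⋆ w) [ v ]   ≈⟨ Sw q v ⟩
                q [ w • v ]     ≈⟨ cong (fun (mor U) q) (•-cong w≈w' (≈refl {alg})) ⟩
                q [ w' • v ]    ∎
            ; op-closed = λ o ws Sws q v → begin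
                (q ⋆ op alg o ws) [ v ]            ≈⟨ [-]-cong v (hom (h run) o ws q) ⟩
                op Q o (λ i → q ⋆ ws i) [ v ]      ≈⟨ hom (mor U) o _ v ⟩
                op Y o (λ i → (q ⋆ ws i) [ v ])    ≈⟨ op-cong Y o (λ i → Sws i q v) ⟩
                op Y o (λ i → q [ ws i • v ])      ≈⟨ hom (fun (mor U) q) o _ ⟨
                q [ op alg o (λ i → ws i • v) ]    ≈⟨ cong (fun (mor U) q) (bimˡ v o ws) ⟨
                q [ op alg o ws • v ]              ∎
            ; ε-closed  = λ q v → ≈trans {Y} ([-]-cong v (h-unit run q))
                                             (≈sym {Y} (cong (fun (mor U) q) (identityˡ v)))
            ; •-closed  = λ {w₁} {w₂} S₁ S₂ q v → begin
                (q ⋆ (w₁ • w₂)) [ v ]  ≈⟨ [-]-cong v (h-• run w₁ w₂ q) ⟩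
                (q ⋆ w₁ ⋆ w₂) [ v ]    ≈⟨ S₂ (q ⋆ w₁) v ⟩
                (q ⋆ w₁) [ w₂ • v ]    ≈⟨ S₁ q (w₂ • v) ⟩
                q [ w₁ • (w₂ • v) ]    ≈⟨ cong (fun (mor U) q) (assoc w₁ w₂ v) ⟨
                q [ (w₁ • w₂) • v ]    ∎ }
            where open ≈-Reasoning Y

        behaviour-unique : ∀ q → fun (mor U) q ≈[ [ alg , Y ] ] fun behaviour q
        behaviour-unique q w = begin
          q [ w ]            ≈⟨ cong (fun (mor U) q) (identityʳ w) ⟨
          q [ w • unit ]     ≈⟨ ⋆-shifts w q unit ⟨
          (q ⋆ w) [ unit ]   ≈⟨ proj₁ (commutes U (q ⋆ w)) ⟩
          fun output (q ⋆ w) ∎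
          where open ≈-Reasoning Y

    languageCoalg-isFinal : IsFinal languageCoalg
    languageCoalg-isFinal C = behaviourHom C , behaviour-unique C

proposition21 :
  (D : Variety) (comm : IsCommutative D) (X Y : Alg D)
  (X⊛ : Comm.DMonoid D comm) (η : Hom D X (Comm.DMonoid.alg X⊛)) →
  Comm.IsFreeDMonoid D comm X X⊛ η →
  Σ (Hom D (Comm.[_,_] D comm (Comm.DMonoid.alg X⊛) Y)
           (Comm.Functor.T D comm X Y (Comm.[_,_] D comm (Comm.DMonoid.alg X⊛) Y))) λ τf →
    (∀ (L : Hom D (Comm.DMonoid.alg X⊛) Y) →
       Alg._≈_ Y (proj₁ (fun τf L)) (fun L (Comm.DMonoid.unit X⊛))) ×
    (∀ (L : Hom D (Comm.DMonoid.alg X⊛) Y) (a : Alg.Carrier X)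
       (w : Alg.Carrier (Comm.DMonoid.alg X⊛)) →
       Alg._≈_ Y (fun (fun (proj₂ (fun τf L)) a) w)
                 (fun L (Comm.DMonoid._•_ X⊛ (fun η a) w))) ×
    Comm.Functor.IsFinal D comm X Y
      (Comm.Functor.coalg (Comm.[_,_] D comm (Comm.DMonoid.alg X⊛) Y) τf)
proposition21 D comm X Y X⊛ η free =
  languageStructure , (λ _ → ≈refl {Y}) , (λ _ _ _ → ≈refl {Y}) , languageCoalg-isFinal
  where
  open Comm D comm using (≈refl)
  open Languages D comm X Y X⊛ η
  open Finality D comm X Y X⊛ η free
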